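{- Let $t$ be an odd positive integer and let $\pi$ be a $t$-core. Then $$-\Big\lfloor\frac{t-1}{4}\Big\rfloor\le \mathrm{BG\text{ - }rank}(\pi)\le \Big\lfloor\frac{t+1}{4}\Big\rfloor.$$
   Context: For a partition $\pi=(\lambda_1\ge\lambda_2\ge\cdots)$ (with $\lambda_i=0$ beyond the number of parts), $\mathrm{BG\text{ - }rank}(\pi)=\sum_{j\ge1}(-1)^{j+1}\frac{1-(-1)^{\lambda_j}}{2}$. A $t$-core is a partition whose Young diagram has no rim hook of length $t$ (equivalently, no hook length divisible by $t$). $\lfloor x\rfloor$ is the integer part of $x$. -}

module Defs where

open import Data.Nat using (ℕ; zero; suc; _+_; _∸_; _≤_; _<_; _≥_)
open import Data.Nat.Divisibility using (_∣_)
open import Data.Integer as ℤ using (ℤ; +_)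
open import Data.List using (List; []; _∷_; length; filter)
open import Data.List.Relation.Unary.All using (All)
open import Data.List.Relation.Unary.Linked using (Linked)
open import Data.Nat using (_<?_)
open import Relation.Nullary using (¬_)
open import Data.Product using (_×_)

IsPartition : List ℕ → Set
IsPartition λs = Linked _≥_ λs × All (λ p → 0 < p) λs

-- λ_i (0-indexed), with λ_i = 0 beyond the number of parts
part : List ℕ → ℕ → ℕ
part [] _ = 0
part (p ∷ _) zero = p
part (_ ∷ ps) (suc i) = part ps i

conj : List ℕ → ℕ → ℕ
conj λs j = length (filter (j <?_) λs)

-- hook length of cell (i , j) (0-indexed, meaningful when j < λ_i)
hookLength : List ℕ → ℕ → ℕ → ℕ
hookLength λs i j = (part λs i ∸ j) + (conj λs j ∸ i) ∸ 1

IsCore : ℕ → List ℕ → Set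
IsCore t λs = ∀ i j → j < part λs i → ¬ (t ∣ hookLength λs i j)

parity : ℕ → ℕ
parity zero = 0
parity (suc zero) = 1
parity (suc (suc n)) = parity n

-- BG-rank(π) = Σ_{j≥1} (-1)^{j+1} (1-(-1)^{λ_j})/2, summed over the parts
-- (parts beyond the length are 0 and contribute 0).
bgRank : List ℕ → ℤ
bgRank [] = + 0
bgRank (p ∷ ps) = + parity p ℤ.- bgRank ps

{-# OPTIONS --safe #-}
-- Encode π (with ℓ parts) by its β-set β = {λᵢ + ℓ − 1 − i}, for which
-- 2·Σ_{b∈β} (−1)^b − 1 = (−1)^ℓ (4·BG(π) − 1). A hook of length t in the first row is a
-- bead b₀ such that b₀ − t is not a bead, so, row by row, the β-set of a t-core is closed
-- under b ↦ b − t. On the t-abacus each runner r then carries the beads r, r + t, …,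
-- r + (m − 1)t, whose signs alternate because t is odd: runner r contributes 0 or (−1)^r.
-- With (t + 1)/2 even and (t − 1)/2 odd runners, |2·Σ(−1)^b − 1| ≤ t, that is
-- 1 − t ≤ 4·BG(π) ≤ t + 1, and the claim follows by taking integer parts.
module Submission where

open import Defs
open import Data.Nat using (ℕ; suc; _*_; _∸_; _+_; _/_)
open import Data.Integer as ℤ using (ℤ; +_; -_; _≤_)
open import Data.List using (List)
open import Data.Product using (_×_)

import Algebra.Properties.CommutativeSemigroup as CommutativeSemigroupProperties
open import Data.Bool using (true; false; if_then_else_)
open import Data.Integer using (0ℤ; 1ℤ; -1ℤ; -[1+_]; +≤+; -≤+)
import Data.Integer.Properties as ℤ
open import Data.Integer.Tactic.RingSolver using (solve-∀)
open import Data.List using ([]; _∷_; length; filter)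
open import Data.List.Properties using (filter-accept; filter-reject; filter-none; length-filter)
open import Data.List.Membership.Propositional using (_∈_; _∉_)
open import Data.List.Membership.Propositional.Properties using (∈-filter⁺)
open import Data.List.Relation.Unary.All as All using (All; []; _∷_)
open import Data.List.Relation.Unary.All.Properties using (filter⁺)
open import Data.List.Relation.Unary.Any using (here; there)
open import Data.List.Relation.Unary.Linked as Linked using (Linked; [-]; _∷_)
open import Data.List.Relation.Unary.Linked.Properties using (Linked⇒All)
open import Data.Nat using (zero; _<_; _≥_; _≟_; _<?_; _≤?_; _%_; NonZero; z≤n; s≤s)
import Data.Nat as ℕ
import Data.Nat.Properties as ℕ
open import Data.Nat.DivMod using (m<n⇒m%n≡m; m≤n⇒[n∸m]%m≡n%m; m%n<n; m*n/n≡m; /-monoˡ-≤)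
open import Data.Nat.Divisibility using (_∣_; ∣-refl)
open import Data.List.Membership.DecPropositional _≟_ using (_∈?_)
open import Data.Product using (_,_; ∃-syntax)
open import Function using (_∘_)
open import Relation.Binary.Definitions using (tri<; tri≈; tri>)
open import Relation.Binary.PropositionalEquality
  using (_≡_; _≢_; refl; sym; trans; cong; cong₂; subst; subst₂; module ≡-Reasoning)
open import Relation.Nullary using (yes; no; does; contradiction)
open import Relation.Nullary.Decidable using (dec-true; dec-false)
open import Relation.Unary using (Decidable)

module ℕ+ = CommutativeSemigroupProperties ℕ.+-commutativeSemigroup
module ℤ+ = CommutativeSemigroupProperties ℤ.+-commutativeSemigroup

infix 8 -1^_

-1^_ : ℕ → ℤ
-1^ n = -1ℤ ℤ.^ n

-1^-suc : ∀ n → -1^ suc n ≡ - -1^ n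
-1^-suc n = ℤ.-1*i≡-i (-1^ n)

-1^-2+ : ∀ n → -1^ (2 + n) ≡ -1^ n
-1^-2+ n = trans (-1^-suc (suc n)) (trans (cong -_ (-1^-suc n)) (ℤ.neg-involutive (-1^ n)))

∣-1^n∣≡1 : ∀ n → ℤ.∣ -1^ n ∣ ≡ 1
∣-1^n∣≡1 zero    = refl
∣-1^n∣≡1 (suc n) = trans (cong ℤ.∣_∣ (-1^-suc n)) (trans (ℤ.∣-i∣≡∣i∣ (-1^ n)) (∣-1^n∣≡1 n))

∣-1^n*i∣≡∣i∣ : ∀ n i → ℤ.∣ -1^ n ℤ.* i ∣ ≡ ℤ.∣ i ∣
∣-1^n*i∣≡∣i∣ n i = begin
  ℤ.∣ -1^ n ℤ.* i ∣          ≡⟨ ℤ.∣i*j∣≡∣i∣*∣j∣ (-1^ n) i ⟩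
  ℤ.∣ -1^ n ∣ * ℤ.∣ i ∣      ≡⟨ cong (_* ℤ.∣ i ∣) (∣-1^n∣≡1 n) ⟩
  1 * ℤ.∣ i ∣                ≡⟨ ℕ.*-identityˡ ℤ.∣ i ∣ ⟩
  ℤ.∣ i ∣                    ∎
  where open ≡-Reasoning

-1^≡1-2parity : ∀ n → -1^ n ≡ 1ℤ ℤ.- + 2 ℤ.* + parity n
-1^≡1-2parity zero          = refl
-1^≡1-2parity (suc zero)    = refl
-1^≡1-2parity (suc (suc n)) = trans (-1^-2+ n) (-1^≡1-2parity n)

parity-suc : ∀ n → + parity (suc n) ≡ + parity n ℤ.+ -1^ n
parity-suc zero          = refl
parity-suc (suc zero)    = refl
parity-suc (suc (suc n)) = trans (parity-suc n) (cong (ℤ._+_ (+ parity n)) (sym (-1^-2+ n)))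

parity-2k+1 : ∀ k → parity (2 * k + 1) ≡ 1
parity-2k+1 zero    = refl
parity-2k+1 (suc k) = trans (cong (λ m → parity (m + 1)) (ℕ.*-suc 2 k)) (parity-2k+1 k)

odd⇒nonZero : ∀ {t} → parity t ≡ 1 → NonZero t
odd⇒nonZero {zero}  ()
odd⇒nonZero {suc t} _ = _

-1^-odd : ∀ {t} → parity t ≡ 1 → -1^ t ≡ -1ℤ
-1^-odd {t} t-odd = trans (-1^≡1-2parity t) (cong (λ p → 1ℤ ℤ.- + 2 ℤ.* + p) t-odd)

-1^-+odd : ∀ {t} → parity t ≡ 1 → ∀ n → -1^ (n + t) ≡ - -1^ n
-1^-+odd {t} t-odd n = begin
  -1^ (n + t)        ≡⟨ ℤ.^-distribˡ-+-* -1ℤ n t ⟩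
  -1^ n ℤ.* -1^ t    ≡⟨ cong (ℤ._*_ (-1^ n)) (-1^-odd {t} t-odd) ⟩
  -1^ n ℤ.* -1ℤ      ≡⟨ ℤ.*-comm (-1^ n) -1ℤ ⟩
  -1ℤ ℤ.* -1^ n      ≡⟨ ℤ.-1*i≡-i (-1^ n) ⟩
  - -1^ n            ∎
  where open ≡-Reasoning

sumBelow : ℕ → (ℕ → ℤ) → ℤ
sumBelow zero    f = 0ℤ
sumBelow (suc n) f = sumBelow n f ℤ.+ f n

syntax sumBelow n (λ r → e) = ∑[ r < n ] e

sumBelow-cong : ∀ n {f g : ℕ → ℤ} → (∀ r → r < n → f r ≡ g r) → sumBelow n f ≡ sumBelow n g
sumBelow-cong zero    _   = refl
sumBelow-cong (suc n) f≗g =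
  cong₂ ℤ._+_ (sumBelow-cong n (λ r r<n → f≗g r (ℕ.m<n⇒m<1+n r<n))) (f≗g n (ℕ.n<1+n n))

sumBelow-zero : ∀ n → ∑[ r < n ] 0ℤ ≡ 0ℤ
sumBelow-zero zero    = refl
sumBelow-zero (suc n) = trans (ℤ.+-identityʳ _) (sumBelow-zero n)

sumBelow-distrib-+ : ∀ n (f g : ℕ → ℤ) → ∑[ r < n ] (f r ℤ.+ g r) ≡ sumBelow n f ℤ.+ sumBelow n g
sumBelow-distrib-+ zero    f g = refl
sumBelow-distrib-+ (suc n) f g =
  trans (cong (ℤ._+ (f n ℤ.+ g n)) (sumBelow-distrib-+ n f g))
        (ℤ+.interchange (sumBelow n f) (sumBelow n g) (f n) (g n))

indicator-≢ : ∀ {c r} (x : ℤ) → c ≢ r → (if does (c ≟ r) then x else 0ℤ) ≡ 0ℤ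
indicator-≢ {c} {r} x c≢r = cong (if_then x else 0ℤ) (dec-false (c ≟ r) c≢r)

sumBelow-indicator : ∀ {n c} (x : ℤ) → c < n → ∑[ r < n ] (if does (c ≟ r) then x else 0ℤ) ≡ x
sumBelow-indicator {suc n} {c} x c<1+n with c ≟ n
... | no c≢n  = trans (cong₂ ℤ._+_ (sumBelow-indicator x c<n) (indicator-≢ x c≢n)) (ℤ.+-identityʳ x)
  where
  c<n : c < n
  c<n = ℕ.≤∧≢⇒< (ℕ.≤-pred c<1+n) c≢n
... | yes refl = trans (cong₂ ℤ._+_ below-c at-c) (ℤ.+-identityˡ x)
  where
  below-c : ∑[ r < c ] (if does (c ≟ r) then x else 0ℤ) ≡ 0ℤ
  below-c = trans (sumBelow-cong c (λ r r<c → indicator-≢ x (ℕ.<⇒≢ r<c ∘ sym))) (sumBelow-zero c)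
  at-c : (if does (c ≟ c) then x else 0ℤ) ≡ x
  at-c = cong (if_then x else 0ℤ) (dec-true (c ≟ c) refl)

-- The hypothesis says f r ∈ {0, (−1)^r}, so the sum lies between −⌊n/2⌋ and ⌈n/2⌉.
∣2∑-parity∣≤n : ∀ n (f : ℕ → ℤ) → (∀ r → r < n → ℤ.∣ + 2 ℤ.* f r ℤ.- -1^ r ∣ ℕ.≤ 1) →
       ℤ.∣ + 2 ℤ.* sumBelow n f ℤ.- + parity n ∣ ℕ.≤ n
∣2∑-parity∣≤n zero    f _       = z≤n
∣2∑-parity∣≤n (suc n) f bounded = begin
  ℤ.∣ + 2 ℤ.* (S ℤ.+ f n) ℤ.- + parity (suc n) ∣
    ≡⟨ cong (λ p → ℤ.∣ + 2 ℤ.* (S ℤ.+ f n) ℤ.- p ∣) (parity-suc n) ⟩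
  ℤ.∣ + 2 ℤ.* (S ℤ.+ f n) ℤ.- (+ parity n ℤ.+ -1^ n) ∣
    ≡⟨ cong ℤ.∣_∣ (regroup S (f n) (+ parity n) (-1^ n)) ⟩
  ℤ.∣ (+ 2 ℤ.* S ℤ.- + parity n) ℤ.+ (+ 2 ℤ.* f n ℤ.- -1^ n) ∣
    ≤⟨ ℤ.∣i+j∣≤∣i∣+∣j∣ (+ 2 ℤ.* S ℤ.- + parity n) (+ 2 ℤ.* f n ℤ.- -1^ n) ⟩
  ℤ.∣ + 2 ℤ.* S ℤ.- + parity n ∣ + ℤ.∣ + 2 ℤ.* f n ℤ.- -1^ n ∣
    ≤⟨ ℕ.+-mono-≤ (∣2∑-parity∣≤n n f (λ r r<n → bounded r (ℕ.m<n⇒m<1+n r<n)))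
                  (bounded n (ℕ.n<1+n n)) ⟩
  n + 1
    ≡⟨ ℕ.+-comm n 1 ⟩
  suc n ∎
  where
  open ℕ.≤-Reasoning
  S : ℤ
  S = sumBelow n f
  regroup : ∀ s y p e → + 2 ℤ.* (s ℤ.+ y) ℤ.- (p ℤ.+ e) ≡ (+ 2 ℤ.* s ℤ.- p) ℤ.+ (+ 2 ℤ.* y ℤ.- e)
  regroup = solve-∀

signSum : List ℕ → ℤ
signSum []       = 0ℤ
signSum (b ∷ bs) = -1^ b ℤ.+ signSum bs

signSum-filter-∷ : ∀ {P : ℕ → Set} (P? : Decidable P) b bs →
                   signSum (filter P? (b ∷ bs)) ≡ (if does (P? b) then -1^ b else 0ℤ) ℤ.+ signSum (filter P? bs)
signSum-filter-∷ P? b bs with does (P? b)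
... | true  = refl
... | false = sym (ℤ.+-identityˡ _)

runner : (t : ℕ) .{{_ : NonZero t}} → ℕ → List ℕ → List ℕ
runner t r = filter (λ b → b % t ≟ r)

signSum≡∑runners : ∀ t .{{_ : NonZero t}} B → signSum B ≡ ∑[ r < t ] signSum (runner t r B)
signSum≡∑runners t []      = sym (sumBelow-zero t)
signSum≡∑runners t (b ∷ B) = begin
  -1^ b ℤ.+ signSum B
    ≡⟨ cong₂ ℤ._+_ (sym (sumBelow-indicator (-1^ b) (m%n<n b t))) (signSum≡∑runners t B) ⟩
  ∑[ r < t ] (if does (b % t ≟ r) then -1^ b else 0ℤ) ℤ.+ ∑[ r < t ] signSum (runner t r B)
    ≡⟨ sym (sumBelow-distrib-+ t _ _) ⟩
  ∑[ r < t ] ((if does (b % t ≟ r) then -1^ b else 0ℤ) ℤ.+ signSum (runner t r B))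
    ≡⟨ sumBelow-cong t (λ r _ → sym (signSum-filter-∷ (λ c → c % t ≟ r) b B)) ⟩
  ∑[ r < t ] signSum (runner t r (b ∷ B)) ∎
  where open ≡-Reasoning

-- r + (m ∸ 1) * t, …, r + t, r: runner r of a t-abacus with its m beads pushed to the bottom.
data Ladder (t r : ℕ) : List ℕ → Set where
  []     : Ladder t r []
  bottom : Ladder t r (r ∷ [])
  step   : ∀ {c cs} → Ladder t r (c ∷ cs) → Ladder t r (c + t ∷ c ∷ cs)

module _ {t r : ℕ} where

  ladder-≤-top : ∀ {c cs x} → Ladder t r (c ∷ cs) → x ∈ c ∷ cs → x ℕ.≤ c
  ladder-≤-top _            (here refl) = ℕ.≤-refl
  ladder-≤-top bottom       (there ())
  ladder-≤-top (step {c} l) (there x∈)  = ℕ.≤-trans (ladder-≤-top l x∈) (ℕ.m≤m+n c t)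

  ladder-top-unique : ∀ {c cs x} → Ladder t r (c ∷ cs) → x ∈ c ∷ cs → c < x + t → x ≡ c
  ladder-top-unique _        (here refl) _       = refl
  ladder-top-unique bottom   (there ())  _
  ladder-top-unique (step l) (there x∈)  c+t<x+t =
    contradiction (ℕ.+-monoˡ-≤ t (ladder-≤-top l x∈)) (ℕ.<⇒≱ c+t<x+t)

  ladder-push : ∀ {b L} → t ℕ.≤ b → All (_< b) L → b ∸ t ∈ L → Ladder t r L → Ladder t r (b ∷ L)
  ladder-push {b} {c ∷ cs} t≤b (c<b ∷ _) b∸t∈L l = subst (λ x → Ladder t r (x ∷ c ∷ cs)) c+t≡b (step l)
    where
    b∸t≡c : b ∸ t ≡ c
    b∸t≡c = ladder-top-unique l b∸t∈L (subst (c <_) (sym (ℕ.m∸n+n≡m t≤b)) c<b)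
    c+t≡b : c + t ≡ b
    c+t≡b = trans (cong (_+ t) (sym b∸t≡c)) (ℕ.m∸n+n≡m t≤b)

module _ {t} (t-odd : parity t ≡ 1) where

  ladder-signSum : ∀ {r c cs} → Ladder t r (c ∷ cs) → + 2 ℤ.* signSum (c ∷ cs) ≡ -1^ r ℤ.+ -1^ c
  ladder-signSum {r} bottom = double (-1^ r)
    where
    double : ∀ a → + 2 ℤ.* (a ℤ.+ 0ℤ) ≡ a ℤ.+ a
    double = solve-∀
  ladder-signSum {r} (step {c} {cs} l) = begin
    + 2 ℤ.* (-1^ (c + t) ℤ.+ signSum (c ∷ cs))
      ≡⟨ cong (λ e → + 2 ℤ.* (e ℤ.+ signSum (c ∷ cs))) (-1^-+odd t-odd c) ⟩
    + 2 ℤ.* (- -1^ c ℤ.+ signSum (c ∷ cs))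
      ≡⟨ ℤ.*-distribˡ-+ (+ 2) (- -1^ c) (signSum (c ∷ cs)) ⟩
    + 2 ℤ.* - -1^ c ℤ.+ + 2 ℤ.* signSum (c ∷ cs)
      ≡⟨ cong (ℤ._+_ (+ 2 ℤ.* - -1^ c)) (ladder-signSum l) ⟩
    + 2 ℤ.* - -1^ c ℤ.+ (-1^ r ℤ.+ -1^ c)
      ≡⟨ flip-top (-1^ r) (-1^ c) ⟩
    -1^ r ℤ.+ - -1^ c
      ≡⟨ cong (ℤ._+_ (-1^ r)) (sym (-1^-+odd t-odd c)) ⟩
    -1^ r ℤ.+ -1^ (c + t) ∎
    where
    open ≡-Reasoning
    flip-top : ∀ s a → + 2 ℤ.* - a ℤ.+ (s ℤ.+ a) ≡ s ℤ.+ - a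
    flip-top = solve-∀

  ladder-runnerSum : ∀ {r R} → Ladder t r R → ℤ.∣ + 2 ℤ.* signSum R ℤ.- -1^ r ∣ ≡ 1
  ladder-runnerSum {r} {[]} [] = begin
    ℤ.∣ 0ℤ ℤ.- -1^ r ∣  ≡⟨ cong ℤ.∣_∣ (ℤ.+-identityˡ (- -1^ r)) ⟩
    ℤ.∣ - -1^ r ∣       ≡⟨ ℤ.∣-i∣≡∣i∣ (-1^ r) ⟩
    ℤ.∣ -1^ r ∣         ≡⟨ ∣-1^n∣≡1 r ⟩
    1                   ∎
    where open ≡-Reasoning
  ladder-runnerSum {r} {c ∷ cs} l = begin
    ℤ.∣ + 2 ℤ.* signSum (c ∷ cs) ℤ.- -1^ r ∣  ≡⟨ cong (λ s → ℤ.∣ s ℤ.- -1^ r ∣) (ladder-signSum l) ⟩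
    ℤ.∣ -1^ r ℤ.+ -1^ c ℤ.- -1^ r ∣           ≡⟨ cong ℤ.∣_∣ (cancel (-1^ r) (-1^ c)) ⟩
    ℤ.∣ -1^ c ∣                               ≡⟨ ∣-1^n∣≡1 c ⟩
    1                                         ∎
    where
    open ≡-Reasoning
    cancel : ∀ s a → s ℤ.+ a ℤ.- s ≡ a
    cancel = solve-∀

data ShiftClosed (t : ℕ) : List ℕ → Set where
  []   : ShiftClosed t []
  cons : ∀ {b bs} → All (_< b) bs → (t ℕ.≤ b → b ∸ t ∈ bs) → ShiftClosed t bs → ShiftClosed t (b ∷ bs)

module _ {t} .{{_ : NonZero t}} where

  runner-below : ∀ {r bs} → r < t → All (_< r) bs → runner t r bs ≡ []
  runner-below {r} r<t = filter-none (λ c → c % t ≟ r) ∘ All.map off-runner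
    where
    off-runner : ∀ {c} → c < r → c % t ≢ r
    off-runner c<r c%t≡r = ℕ.<⇒≢ c<r (trans (sym (m<n⇒m%n≡m (ℕ.<-trans c<r r<t))) c%t≡r)

  runner-ladder-base : ∀ {b bs r} → b < t → b % t ≡ r → All (_< b) bs → Ladder t r (b ∷ runner t r bs)
  runner-ladder-base b<t b%t≡r below with trans (sym (m<n⇒m%n≡m b<t)) b%t≡r
  ... | refl rewrite runner-below b<t below = bottom

  runner-ladder : ∀ {B} → ShiftClosed t B → ∀ r → Ladder t r (runner t r B)
  runner-ladder []                                  r = []
  runner-ladder (cons {b} {bs} below closed closed′) r with b % t ≟ r
  ... | no b%t≢r rewrite filter-reject (λ c → c % t ≟ r) {xs = bs} b%t≢r = runner-ladder closed′ r
  ... | yes b%t≡r rewrite filter-accept (λ c → c % t ≟ r) {xs = bs} b%t≡r with t ≤? b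
  ...   | no t≰b  = runner-ladder-base (ℕ.≰⇒> t≰b) b%t≡r below
  ...   | yes t≤b = ladder-push t≤b (filter⁺ _ below) b∸t∈runner (runner-ladder closed′ r)
    where
    b∸t∈runner : b ∸ t ∈ runner t r bs
    b∸t∈runner = ∈-filter⁺ (λ c → c % t ≟ r) (closed t≤b) (trans (m≤n⇒[n∸m]%m≡n%m t≤b) b%t≡r)

-- First-column hook lengths λᵢ + (ℓ − 1 − i): the β-set of the partition.
beta : List ℕ → List ℕ
beta []       = []
beta (p ∷ ps) = p + length ps ∷ beta ps

parts-≤-head : ∀ {q qs} → Linked _≥_ (q ∷ qs) → All (ℕ._≤ q) qs
parts-≤-head [-]          = []
parts-≤-head (q≥q′ ∷ rest) = Linked⇒All (λ i≥j j≥k → ℕ.≤-trans j≥k i≥j) q≥q′ rest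

part-≤-head : ∀ {q qs} → All (ℕ._≤ q) qs → ∀ i → part qs i ℕ.≤ q
part-≤-head []         _       = z≤n
part-≤-head (q′≤q ∷ _) zero    = q′≤q
part-≤-head (_ ∷ qs≤q) (suc i) = part-≤-head qs≤q i

conj-∷-< : ∀ {j q} qs → j < q → conj (q ∷ qs) j ≡ suc (conj qs j)
conj-∷-< {j} qs j<q = cong length (filter-accept (j <?_) {xs = qs} j<q)

conj-≡0 : ∀ {j qs} → All (ℕ._≤ j) qs → conj qs j ≡ 0
conj-≡0 {j} qs≤j = cong length (filter-none (j <?_) (All.map ℕ.≤⇒≯ qs≤j))

beta-< : ∀ {p ps} → All (ℕ._≤ p) ps → All (_< p + length ps) (beta ps)
beta-<         []                        = []
beta-< {p} {q ∷ qs} (q≤p ∷ qs≤p) =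
  ℕ.+-mono-≤-< q≤p (ℕ.n<1+n (length qs)) ∷ All.map (λ x<p+m → ℕ.<-trans x<p+m p+m<p+1+m) (beta-< qs≤p)
  where
  p+m<p+1+m : p + length qs < p + suc (length qs)
  p+m<p+1+m = ℕ.+-monoʳ-< p (ℕ.n<1+n (length qs))

gap<head⇒column<head : ∀ {q qs j} → Linked _≥_ (q ∷ qs) →
                       j + (length qs ∸ conj qs j) < q + length qs → j < q
gap<head⇒column<head {q} {qs} {j} sorted gap< with j <? q
... | yes j<q = j<q
... | no  j≮q = contradiction gap< (ℕ.≤⇒≯ (begin
  q + length qs                    ≤⟨ ℕ.+-monoˡ-≤ (length qs) q≤j ⟩
  j + length qs                    ≡⟨ cong (λ c → j + (length qs ∸ c)) (sym (conj-≡0 qs≤j)) ⟩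
  j + (length qs ∸ conj qs j)      ∎))
  where
  open ℕ.≤-Reasoning
  q≤j : q ℕ.≤ j
  q≤j = ℕ.≮⇒≥ j≮q
  qs≤j : All (ℕ._≤ j) qs
  qs≤j = All.map (λ x≤q → ℕ.≤-trans x≤q q≤j) (parts-≤-head sorted)

-- The complement of β(λ) is {j + ℓ − λ′ⱼ : j ∈ ℕ}; only this inclusion is needed.
beta-gap : ∀ {qs} → Linked _≥_ qs → ∀ {g} → g ∉ beta qs → ∃[ j ] j + (length qs ∸ conj qs j) ≡ g
beta-gap {[]}     _      {g} _  = g , ℕ.+-identityʳ g
beta-gap {q ∷ qs} sorted {g} g∉ with ℕ.<-cmp g (q + length qs)
... | tri≈ _ g≡ _ = contradiction (here g≡) g∉
... | tri> _ _ g> = j , j+gap≡g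
  where
  j : ℕ
  j = g ∸ suc (length qs)
  q+1+n≤g : q + suc (length qs) ℕ.≤ g
  q+1+n≤g = subst (ℕ._≤ g) (sym (ℕ.+-suc q (length qs))) g>
  q≤j : q ℕ.≤ j
  q≤j = ℕ.m+n≤o⇒m≤o∸n q q+1+n≤g
  j+gap≡g : j + (suc (length qs) ∸ conj (q ∷ qs) j) ≡ g
  j+gap≡g rewrite conj-≡0 (q≤j ∷ All.map (λ x≤q → ℕ.≤-trans x≤q q≤j) (parts-≤-head sorted)) =
    ℕ.m∸n+n≡m (ℕ.≤-trans (ℕ.m≤n+m (suc (length qs)) q) q+1+n≤g)
... | tri< g< _ _ with beta-gap (Linked.tail sorted) (g∉ ∘ there)
...   | j , j+gap≡g = j , trans (cong (λ c → j + (suc (length qs) ∸ c)) (conj-∷-< qs j<q)) j+gap≡g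
  where
  j<q : j < q
  j<q = gap<head⇒column<head sorted (subst (_< q + length qs) (sym j+gap≡g) g<)

hook-first-row : ∀ {p ps j} → j < p →
                 hookLength (p ∷ ps) 0 j + (j + (length ps ∸ conj ps j)) ≡ p + length ps
hook-first-row {p} {ps} {j} j<p = begin
  hookLength (p ∷ ps) 0 j + (j + (n ∸ c))
    ≡⟨ cong (λ h → h ∸ 1 + (j + (n ∸ c))) hook≡ ⟩
  ((p ∸ j) + c) + (j + (n ∸ c))
    ≡⟨ ℕ+.interchange (p ∸ j) c j (n ∸ c) ⟩
  ((p ∸ j) + j) + (c + (n ∸ c))
    ≡⟨ cong₂ _+_ (ℕ.m∸n+n≡m (ℕ.<⇒≤ j<p)) (ℕ.m+[n∸m]≡n (length-filter (j <?_) ps)) ⟩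
  p + n ∎
  where
  open ≡-Reasoning
  n c : ℕ
  n = length ps
  c = conj ps j
  hook≡ : (p ∸ j) + conj (p ∷ ps) j ≡ suc ((p ∸ j) + c)
  hook≡ = trans (cong (_+_ (p ∸ j)) (conj-∷-< ps j<p)) (ℕ.+-suc (p ∸ j) c)

IsCore-tail : ∀ {t p ps} → Linked _≥_ (p ∷ ps) → IsCore t (p ∷ ps) → IsCore t ps
IsCore-tail {t} {p} {ps} sorted core i j j<λᵢ t∣hook =
  core (suc i) j j<λᵢ (subst (t ∣_) (sym hook≡) t∣hook)
  where
  hook≡ : hookLength (p ∷ ps) (suc i) j ≡ hookLength ps i j
  hook≡ = cong (λ c → (part ps i ∸ j) + (c ∸ suc i) ∸ 1)
               (conj-∷-< ps (ℕ.<-≤-trans j<λᵢ (part-≤-head (parts-≤-head sorted) i)))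

module _ {t} .{{_ : NonZero t}} where

  -- If b − t, for the first bead b, were a gap j + (ℓ − λ′ⱼ), the cell (0, j) would have hook length t.
  beta-head-closed : ∀ {p ps} → Linked _≥_ (p ∷ ps) → IsCore t (p ∷ ps) →
                     t ℕ.≤ p + length ps → p + length ps ∸ t ∈ beta ps
  beta-head-closed {p} {ps} sorted core t≤b with p + length ps ∸ t ∈? beta ps
  ... | yes g∈ = g∈
  ... | no  g∉ with beta-gap (Linked.tail sorted) g∉
  ...   | j , j+gap≡g = contradiction (subst (t ∣_) (sym hook≡t) ∣-refl) (core 0 j j<p)
    where
    b g : ℕ
    b = p + length ps
    g = b ∸ t
    j<p : j < p
    j<p = gap<head⇒column<head sorted (subst (_< b) (sym j+gap≡g) (ℕ.∸-monoʳ-< (ℕ.>-nonZero⁻¹ t) t≤b))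
    h : ℕ
    h = hookLength (p ∷ ps) 0 j
    hook≡t : h ≡ t
    hook≡t = ℕ.+-cancelˡ-≡ g h t (begin
      g + h                                      ≡⟨ ℕ.+-comm g h ⟩
      h + g                                      ≡⟨ cong (_+_ h) (sym j+gap≡g) ⟩
      h + (j + (length ps ∸ conj ps j))          ≡⟨ hook-first-row j<p ⟩
      b                                          ≡⟨ sym (ℕ.m∸n+n≡m t≤b) ⟩
      g + t                                      ∎)
      where open ≡-Reasoning

  beta-shiftClosed : ∀ {π} → Linked _≥_ π → IsCore t π → ShiftClosed t (beta π)
  beta-shiftClosed {[]}     _      _    = []
  beta-shiftClosed {p ∷ ps} sorted core =
    cons (beta-< (parts-≤-head sorted)) (beta-head-closed sorted core)
         (beta-shiftClosed (Linked.tail sorted) (IsCore-tail sorted core))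

signSum-beta : ∀ π → + 2 ℤ.* signSum (beta π) ℤ.- 1ℤ ≡ -1^ length π ℤ.* (+ 4 ℤ.* bgRank π ℤ.- 1ℤ)
signSum-beta []       = refl
signSum-beta (p ∷ ps) = begin
  + 2 ℤ.* (-1^ (p + n) ℤ.+ S) ℤ.- 1ℤ
    ≡⟨ cong (λ e → + 2 ℤ.* (e ℤ.+ S) ℤ.- 1ℤ) (ℤ.^-distribˡ-+-* -1ℤ p n) ⟩
  + 2 ℤ.* (-1^ p ℤ.* -1^ n ℤ.+ S) ℤ.- 1ℤ
    ≡⟨ cong (λ e → + 2 ℤ.* (e ℤ.* -1^ n ℤ.+ S) ℤ.- 1ℤ) (-1^≡1-2parity p) ⟩
  + 2 ℤ.* ((1ℤ ℤ.- + 2 ℤ.* + parity p) ℤ.* -1^ n ℤ.+ S) ℤ.- 1ℤ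
    ≡⟨ regroup (+ parity p) (-1^ n) S ⟩
  (+ 2 ℤ.* S ℤ.- 1ℤ) ℤ.+ -1^ n ℤ.* (+ 2 ℤ.- + 4 ℤ.* + parity p)
    ≡⟨ cong (λ e → e ℤ.+ -1^ n ℤ.* (+ 2 ℤ.- + 4 ℤ.* + parity p)) (signSum-beta ps) ⟩
  -1^ n ℤ.* (+ 4 ℤ.* bgRank ps ℤ.- 1ℤ) ℤ.+ -1^ n ℤ.* (+ 2 ℤ.- + 4 ℤ.* + parity p)
    ≡⟨ factor (-1^ n) (bgRank ps) (+ parity p) ⟩
  - -1^ n ℤ.* (+ 4 ℤ.* (+ parity p ℤ.- bgRank ps) ℤ.- 1ℤ)
    ≡⟨ cong (λ e → e ℤ.* (+ 4 ℤ.* bgRank (p ∷ ps) ℤ.- 1ℤ)) (sym (-1^-suc n)) ⟩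
  -1^ suc n ℤ.* (+ 4 ℤ.* bgRank (p ∷ ps) ℤ.- 1ℤ) ∎
  where
  open ≡-Reasoning
  n : ℕ
  n = length ps
  S : ℤ
  S = signSum (beta ps)
  regroup : ∀ q e s → + 2 ℤ.* ((1ℤ ℤ.- + 2 ℤ.* q) ℤ.* e ℤ.+ s) ℤ.- 1ℤ ≡
                      (+ 2 ℤ.* s ℤ.- 1ℤ) ℤ.+ e ℤ.* (+ 2 ℤ.- + 4 ℤ.* q)
  regroup = solve-∀
  factor : ∀ e b q → e ℤ.* (+ 4 ℤ.* b ℤ.- 1ℤ) ℤ.+ e ℤ.* (+ 2 ℤ.- + 4 ℤ.* q) ≡
                     - e ℤ.* (+ 4 ℤ.* (q ℤ.- b) ℤ.- 1ℤ)
  factor = solve-∀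

module _ {t} (t-odd : parity t ≡ 1) where

  private instance
    t≢0 : NonZero t
    t≢0 = odd⇒nonZero t-odd

  ∣2signSum-1∣≤t : ∀ {B} → ShiftClosed t B → ℤ.∣ + 2 ℤ.* signSum B ℤ.- 1ℤ ∣ ℕ.≤ t
  ∣2signSum-1∣≤t {B} closed = begin
    ℤ.∣ + 2 ℤ.* signSum B ℤ.- 1ℤ ∣
      ≡⟨ cong₂ (λ s q → ℤ.∣ + 2 ℤ.* s ℤ.- + q ∣) (signSum≡∑runners t B) (sym t-odd) ⟩
    ℤ.∣ + 2 ℤ.* (∑[ r < t ] signSum (runner t r B)) ℤ.- + parity t ∣
      ≤⟨ ∣2∑-parity∣≤n t _ (λ r _ → ℕ.≤-reflexive (ladder-runnerSum t-odd (runner-ladder closed r))) ⟩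
    t ∎
    where open ℕ.≤-Reasoning

  ∣4bgRank-1∣≤t : ∀ {π} → Linked _≥_ π → IsCore t π → ℤ.∣ + 4 ℤ.* bgRank π ℤ.- 1ℤ ∣ ℕ.≤ t
  ∣4bgRank-1∣≤t {π} sorted core = begin
    ℤ.∣ + 4 ℤ.* bgRank π ℤ.- 1ℤ ∣                     ≡⟨ sym (∣-1^n*i∣≡∣i∣ (length π) _) ⟩
    ℤ.∣ -1^ length π ℤ.* (+ 4 ℤ.* bgRank π ℤ.- 1ℤ) ∣  ≡⟨ cong ℤ.∣_∣ (sym (signSum-beta π)) ⟩
    ℤ.∣ + 2 ℤ.* signSum (beta π) ℤ.- 1ℤ ∣             ≤⟨ ∣2signSum-1∣≤t (beta-shiftClosed sorted core) ⟩
    t                                                 ∎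
    where open ℕ.≤-Reasoning

m*n≤o⇒m≤o/n : ∀ {m} n {o} .{{_ : NonZero n}} → m * n ℕ.≤ o → m ℕ.≤ o / n
m*n≤o⇒m≤o/n {m} n m*n≤o = subst (ℕ._≤ _) (m*n/n≡m m n) (/-monoˡ-≤ n m*n≤o)

-- In the last two clauses ∣4x − 1∣ computes to 4x − 1 and to 4(m + 1) + 1 respectively.
quarter-bounds : ∀ t x → ℤ.∣ + 4 ℤ.* x ℤ.- 1ℤ ∣ ℕ.≤ t → - (+ ((t ∸ 1) / 4)) ≤ x × x ≤ + ((t + 1) / 4)
quarter-bounds t (+ zero)  _          = ℤ.neg-≤-pos , +≤+ z≤n
quarter-bounds t (+ suc m) ∣4x-1∣≤t = ℤ.neg-≤-pos , +≤+ (m*n≤o⇒m≤o/n 4 [1+m]*4≤t+1)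
  where
  [1+m]*4≤t+1 : suc m * 4 ℕ.≤ t + 1
  [1+m]*4≤t+1 = subst₂ ℕ._≤_ (ℕ.*-comm 4 (suc m)) (ℕ.+-comm 1 t) (s≤s ∣4x-1∣≤t)
quarter-bounds t -[1+ m ]  ∣4x-1∣≤t = ℤ.neg-mono-≤ (+≤+ (m*n≤o⇒m≤o/n 4 [1+m]*4≤t∸1)) , -≤+
  where
  [1+m]*4≤t∸1 : suc m * 4 ℕ.≤ t ∸ 1
  [1+m]*4≤t∸1 = ℕ.m+n≤o⇒m≤o∸n (suc m * 4)
    (subst (ℕ._≤ t) (trans (sym (ℕ.+-suc (4 * suc m) 0)) (cong (_+ 1) (ℕ.*-comm 4 (suc m)))) ∣4x-1∣≤t)

mainTheorem2 : (k : ℕ) (π : List ℕ) → IsPartition π → IsCore (2 * k + 1) π →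
    (- (+ ((2 * k + 1 ∸ 1) / 4)) ≤ bgRank π) × (bgRank π ≤ + ((2 * k + 1 + 1) / 4))
mainTheorem2 k π (sorted , _) core =
  quarter-bounds (2 * k + 1) (bgRank π) (∣4bgRank-1∣≤t (parity-2k+1 k) sorted core)
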